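{- Let $\epsilon$ and $\delta$ be real numbers with $0<\epsilon<\frac{2}{5}$ and $0<\delta\le\frac{1}{30}$, and let $\tau$ be a positive integer. Suppose that $\Gamma$ is a $D$-regular graph on vertex set $[n]$ such that $\|Q^{\tau}_v-U\|<\delta$ for at least $\epsilon n$ vertices $v\in[n]$. Then there exists a set $V'$ of at most $5\delta n$ vertices such that the induced subgraph $\Gamma'$ of $\Gamma$ on $V(\Gamma)\setminus V'$, with $n'=|V(\Gamma')|$, satisfies: every vertex set $X\subseteq V(\Gamma')$ with $|X|\le\frac{1}{2}n'$ satisfies $e(X,V(\Gamma')\setminus X)\ge\frac{\epsilon D}{16\tau}|X|$.
   Context: All graphs are finite simple graphs; $D\ge 1$. For a $D$-regular graph $\Gamma$ on $[n]=\{1,\dots,n\}$, the random walk moves at each step to a uniformly random neighbor of the current vertex, independently of the history. $Q^t_v$ denotes the distribution of the position of the walk started at vertex $v$ after $t$ steps. $U$ is the uniform distribution on $[n]$. For probability distributions $P_1,P_2$ on $[n]$, $\|P_1-P_2\|=\max_{A\subseteq[n]}|P_1(A)-P_2(A)|=\frac12\sum_{j\in[n]}|P_1(j)-P_2(j)|$ (total variation distance). For vertex sets $X,Y$, $e(X,Y)$ is the number of edges with one endpoint in $X$ and the other in $Y$.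
   Formalization: The parameters $\epsilon$ and $\delta$ range over the rationals instead of the real numbers. -}

module Defs where

open import Data.Bool using (Bool; true; false; if_then_else_; _∧_; not)
open import Data.Nat as ℕ using (ℕ; zero; suc; NonZero)
open import Data.Fin using (Fin; zero; suc; _≟_)
open import Data.Fin.Subset using (Subset; ∣_∣; ∁; _∩_)
open import Data.Vec using (Vec; lookup; tabulate)
open import Data.Integer using (+_)
open import Data.Rational using (ℚ; 0ℚ; 1ℚ; _+_; _*_; _-_; _/_; ½; _<_) renaming (∣_∣ to abs)
open import Data.Rational.Properties using (_<?_)
open import Relation.Nullary using (does)
open import Relation.Binary.PropositionalEquality using (_≡_)

record Graph (n : ℕ) : Set where
  field
    adj       : Fin n → Fin n → Bool
    symmetric : ∀ i j → adj i j ≡ adj j i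
    loopless  : ∀ i → adj i i ≡ false
open Graph public

sumℕ : ∀ {n} → (Fin n → ℕ) → ℕ
sumℕ {zero}  f = 0
sumℕ {suc n} f = f zero ℕ.+ sumℕ (λ i → f (suc i))

sumℚ : ∀ {n} → (Fin n → ℚ) → ℚ
sumℚ {zero}  f = 0ℚ
sumℚ {suc n} f = f zero + sumℚ (λ i → f (suc i))

bℕ : Bool → ℕ
bℕ true  = 1
bℕ false = 0

bℚ : Bool → ℚ
bℚ true  = 1ℚ
bℚ false = 0ℚ

degree : ∀ {n} → Graph n → Fin n → ℕ
degree G i = sumℕ (λ j → bℕ (adj G i j))

Regular : ∀ {n} → ℕ → Graph n → Set
Regular {n} D G = ∀ (i : Fin n) → degree G i ≡ D

Dist : ℕ → Set
Dist n = Fin n → ℚ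

-- Q t v : distribution of the position after t steps of the simple random walk
-- started at v, in a D-regular graph (each step: uniform neighbour, prob 1/D per neighbour).
Q : ∀ {n} (D : ℕ) .{{_ : NonZero D}} → Graph n → ℕ → Fin n → Dist n
Q D G zero    v j = if does (v ≟ j) then 1ℚ else 0ℚ
Q D G (suc t) v j = sumℚ (λ k → Q D G t v k * (bℚ (adj G k j) * (+ 1 / D)))

Unif : ∀ (n : ℕ) .{{_ : NonZero n}} → Dist n
Unif n j = + 1 / n

tv : ∀ {n} → Dist n → Dist n → ℚ
tv P₁ P₂ = ½ * sumℚ (λ j → abs (P₁ j - P₂ j))

goodStarts : ∀ {n} .{{_ : NonZero n}} (D : ℕ) .{{_ : NonZero D}} →
             Graph n → (τ : ℕ) → (δ : ℚ) → Subset n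
goodStarts {n} D G τ δ = tabulate (λ v → does (tv (Q D G τ v) (Unif n) <? δ))

-- e(X,Y): number of edges with one endpoint in X and the other in Y
-- (counted as ordered pairs (x,y), x ∈ X, y ∈ Y adjacent; correct for disjoint X, Y,
-- which is the only way it is used)
e : ∀ {n} → Graph n → Subset n → Subset n → ℕ
e G X Y = sumℕ (λ x → sumℕ (λ y → bℕ (lookup X x ∧ (lookup Y y ∧ adj G x y))))

ℕtoℚ : ℕ → ℚ
ℕtoℚ m = + m / 1

{-# OPTIONS --safe #-}
module Submission where

-- Greedily peel off sparse cuts.  Start from V′ = ∅ and, while some X ⊆ ∁V′ with |X| ≤ |∁V′|/2 has
-- e(X, ∁V′ ∖ X) < εD|X|/(16τ), replace V′ by V′ ∪ X; this keeps e(V′, ∁V′) ≤ εD|V′|/(16τ).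
-- A cut (A, ∁A) that sparse must be lopsided: a walk from a δ-mixed start outside A is in A at time τ
-- with probability at least |A|/n − δ (symmetrically for starts in A), whereas, the walk being doubly
-- stochastic, these probabilities summed over all starts outside A are at most τ e(A, ∁A)/D.  With εn
-- mixed starts this gives min(|A|, n − |A|) − δn ≤ |A|/8, which together with |V′| ≤ 5δn before the
-- step and δ ≤ 1/30 gives |V′ ∪ X| ≤ 5δn again.  When no such X is left, V′ is the required set.

open import Defs
open import Algebra.Bundles using (CommutativeRing)
import Algebra.Properties.Semiring.Sum as SemiringSum
open import Data.Bool using (Bool; true; false; not; _∧_; _∨_; if_then_else_)
open import Data.Bool.Properties using (not-involutive; T-≡)
open import Data.Empty using (⊥-elim)
open import Data.Fin using (Fin; zero; suc)
import Data.Fin as Fin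
open import Data.Fin.Subset using (Subset; ∣_∣; ∁; _∩_; _∪_; _⊆_; ⊥)
open import Data.Fin.Subset.Properties using (∣p∣≤n; ∣⊥∣≡0; ∣∁p∣≡n∸∣p∣; drop-∷-⊆; anySubset?; _⊆?_)
open import Data.Integer using (+_)
import Data.Integer.Properties as ℤₚ
open import Data.Nat as ℕ using (ℕ; zero; suc; NonZero)
import Data.Nat.Properties as ℕₚ
open import Data.Nat.Coprimality using (1-coprimeTo) renaming (sym to coprime-sym)
open import Data.Sum using (inj₁; inj₂)
open import Data.Product using (Σ; _×_; _,_)
open import Data.Rational using (ℚ; mkℚ; 0ℚ; 1ℚ; ½; _+_; _*_; _-_; -_; _/_; _<_; _≤_; NonNegative; nonNegative; positive)
  renaming (∣_∣ to abs)
open import Data.Rational.Properties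
open import Data.Vec using (lookup)
import Data.Vec.Properties as Vecₚ
open import Function.Bundles using (Equivalence)
open import Relation.Binary.PropositionalEquality using (_≡_; _≢_; refl; sym; trans; cong; cong₂; subst; module ≡-Reasoning)
open import Relation.Nullary using (¬_; Dec; yes; no; does)
open import Relation.Nullary.Decidable using (dec⇒maybe; _×-dec_; toWitness; isYes; isYes≗does)
open import Tactic.RingSolver.Core.AlmostCommutativeRing using (AlmostCommutativeRing; fromCommutativeRing)
import Tactic.RingSolver.NonReflective as NonReflective

ℚ-ring : AlmostCommutativeRing _ _
ℚ-ring = fromCommutativeRing +-*-commutativeRing (λ q → dec⇒maybe (0ℚ ≟ q))

open NonReflective ℚ-ring using (solve; _⊜_; Κ; _⊕_; _⊗_; ⊝_)

open SemiringSum (CommutativeRing.semiring +-*-commutativeRing)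
  using (sum-syntax; sum-cong-≗; sum-replicate-zero; ∑-distrib-+; ∑-comm; *-distribˡ-sum; *-distribʳ-sum)

private
  variable
    n : ℕ

p≤q⇒0≤q-p : ∀ {p q} → p ≤ q → 0ℚ ≤ q - p
p≤q⇒0≤q-p {p} {q} p≤q = subst (_≤ q - p) (+-inverseʳ p) (+-monoˡ-≤ (- p) p≤q)

0≤q-p⇒p≤q : ∀ {p q} → 0ℚ ≤ q - p → p ≤ q
0≤q-p⇒p≤q {p} {q} 0≤q-p = begin
  p            ≡⟨ +-identityˡ p ⟨
  0ℚ + p       ≤⟨ +-monoˡ-≤ p 0≤q-p ⟩
  (q - p) + p  ≡⟨ solve 2 (λ p q → (q ⊕ ⊝ p ⊕ p) ⊜ q) refl p q ⟩
  q            ∎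
  where open ≤-Reasoning

*-nonNeg : ∀ {p q} → 0ℚ ≤ p → 0ℚ ≤ q → 0ℚ ≤ p * q
*-nonNeg {p} {q} 0≤p 0≤q =
  nonNegative⁻¹ _ {{nonNeg*nonNeg⇒nonNeg p {{nonNegative 0≤p}} q {{nonNegative 0≤q}}}}

scale-nonNeg : ∀ c .{{_ : NonNegative c}} {p} → 0ℚ ≤ p → 0ℚ ≤ c * p
scale-nonNeg c = *-nonNeg (nonNegative⁻¹ c)

*-monoʳ-≤ : ∀ r {p q} → 0ℚ ≤ r → p ≤ q → r * p ≤ r * q
*-monoʳ-≤ r 0≤r = *-monoˡ-≤-nonNeg r {{nonNegative 0≤r}}

p-q≤r⇒p≤q+r : ∀ {p q r} → p - q ≤ r → p ≤ q + r
p-q≤r⇒p≤q+r {p} {q} {r} p-q≤r = begin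
  p              ≡⟨ solve 2 (λ p q → p ⊜ (q ⊕ (p ⊕ ⊝ q))) refl p q ⟩
  q + (p - q)    ≤⟨ +-monoʳ-≤ q p-q≤r ⟩
  q + r          ∎
  where open ≤-Reasoning

p≤q+r⇒p-q≤r : ∀ {p q r} → p ≤ q + r → p - q ≤ r
p≤q+r⇒p-q≤r {p} {q} {r} p≤q+r = begin
  p - q        ≤⟨ +-monoˡ-≤ (- q) p≤q+r ⟩
  q + r - q    ≡⟨ solve 2 (λ q r → (q ⊕ r ⊕ ⊝ q) ⊜ r) refl q r ⟩
  r            ∎
  where open ≤-Reasoning

p≤q+r⇒p-r≤q : ∀ {p q r} → p ≤ q + r → p - r ≤ q
p≤q+r⇒p-r≤q {p} {q} {r} p≤q+r = p≤q+r⇒p-q≤r (subst (p ≤_) (+-comm q r) p≤q+r)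

p+p≤q⇒p≤q-p : ∀ {p q} → p + p ≤ q → p ≤ q - p
p+p≤q⇒p≤q-p {p} {q} p+p≤q = 0≤q-p⇒p≤q (begin
  0ℚ               ≤⟨ p≤q⇒0≤q-p p+p≤q ⟩
  q - (p + p)      ≡⟨ solve 2 (λ p q → (q ⊕ ⊝ (p ⊕ p)) ⊜ (q ⊕ ⊝ p ⊕ ⊝ p)) refl p q ⟩
  (q - p) - p      ∎)
  where open ≤-Reasoning

≤-average : ∀ {u a b} → u ≤ a → u ≤ b → u ≤ ½ * (a + b)
≤-average {u} {a} {b} u≤a u≤b = begin
  u            ≡⟨ solve 1 (λ u → u ⊜ Κ ½ ⊗ (u ⊕ u)) refl u ⟩
  ½ * (u + u)  ≤⟨ *-monoʳ-≤ ½ (≤ᵇ⇒≤ _) (+-mono-≤ u≤a u≤b) ⟩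
  ½ * (a + b)  ∎
  where open ≤-Reasoning

a+b≡c⇒b≡c-a : ∀ a b c → a + b ≡ c → b ≡ c - a
a+b≡c⇒b≡c-a a b c a+b≡c = begin
  b              ≡⟨ solve 2 (λ a b → b ⊜ (a ⊕ b ⊕ ⊝ a)) refl a b ⟩
  (a + b) - a    ≡⟨ cong (_- a) a+b≡c ⟩
  c - a          ∎
  where open ≡-Reasoning

a+a′≡b+b′⇒b-a≡a′-b′ : ∀ a a′ b b′ → a + a′ ≡ b + b′ → b - a ≡ a′ - b′
a+a′≡b+b′⇒b-a≡a′-b′ a a′ b b′ eq = begin
  b - a                  ≡⟨ solve 3 (λ a b b′ → (b ⊕ ⊝ a) ⊜ (b ⊕ b′ ⊕ ⊝ (a ⊕ b′))) refl a b b′ ⟩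
  (b + b′) - (a + b′)    ≡⟨ cong (_- (a + b′)) eq ⟨
  (a + a′) - (a + b′)    ≡⟨ solve 3 (λ a a′ b′ → (a ⊕ a′ ⊕ ⊝ (a ⊕ b′)) ⊜ (a′ ⊕ ⊝ b′)) refl a a′ b′ ⟩
  a′ - b′                ∎
  where open ≡-Reasoning

p≤q+∣p-q∣ : ∀ p q → p ≤ q + abs (p - q)
p≤q+∣p-q∣ p q = begin
  p                  ≡⟨ solve 2 (λ p q → p ⊜ (q ⊕ (p ⊕ ⊝ q))) refl p q ⟩
  q + (p - q)        ≤⟨ +-monoʳ-≤ q (p≤abs[p] (p - q)) ⟩
  q + abs (p - q)    ∎
  where
  open ≤-Reasoning
  p≤abs[p] : ∀ p → p ≤ abs p
  p≤abs[p] p with ≤-total 0ℚ p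
  ... | inj₁ 0≤p = ≤-reflexive (sym (0≤p⇒∣p∣≡p 0≤p))
  ... | inj₂ p≤0 = ≤-trans p≤0 (0≤∣p∣ p)

∣p-q∣≡∣q-p∣ : ∀ p q → abs (p - q) ≡ abs (q - p)
∣p-q∣≡∣q-p∣ p q = trans (cong abs (negate p q)) (∣-p∣≡∣p∣ (q - p))
  where
  negate : ∀ p q → p - q ≡ - (q - p)
  negate = solve 2 (λ p q → (p ⊕ ⊝ q) ⊜ ⊝ (q ⊕ ⊝ p)) refl

ℕtoℚ≡mkℚ : ∀ m → ℕtoℚ m ≡ mkℚ (+ m) 0 (coprime-sym (1-coprimeTo m))
ℕtoℚ≡mkℚ m = normalize-coprime (coprime-sym (1-coprimeTo m))

ℕtoℚ-+ : ∀ a b → ℕtoℚ (a ℕ.+ b) ≡ ℕtoℚ a + ℕtoℚ b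
ℕtoℚ-+ a b rewrite ℕtoℚ≡mkℚ a | ℕtoℚ≡mkℚ b =
  /-cong (trans (ℤₚ.pos-+ a b) (sym (cong₂ Data.Integer._+_ (ℤₚ.*-identityʳ (+ a)) (ℤₚ.*-identityʳ (+ b))))) refl

0≤ℕtoℚ : ∀ m → 0ℚ ≤ ℕtoℚ m
0≤ℕtoℚ m = nonNegative⁻¹ _ {{normalize-nonNeg m 1}}

ℕtoℚ*1/m≡1 : ∀ m .{{_ : NonZero m}} → ℕtoℚ m * (+ 1 / m) ≡ 1ℚ
ℕtoℚ*1/m≡1 (suc k) rewrite ℕtoℚ≡mkℚ (suc k) | normalize-coprime {1} {k} (1-coprimeTo (suc k)) =
  *-inverseʳ (mkℚ (+ suc k) 0 (coprime-sym (1-coprimeTo (suc k))))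

bℚ-∧ : ∀ a b → bℚ (a ∧ b) ≡ bℚ a * bℚ b
bℚ-∧ true  b = sym (*-identityˡ (bℚ b))
bℚ-∧ false b = sym (*-zeroˡ (bℚ b))

0≤bℚ : ∀ b → 0ℚ ≤ bℚ b
0≤bℚ true  = ≤ᵇ⇒≤ _
0≤bℚ false = ≤-refl

bℚ≤1 : ∀ b → bℚ b ≤ 1ℚ
bℚ≤1 true  = ≤-refl
bℚ≤1 false = ≤ᵇ⇒≤ _

bℚ+bℚ∘not≡1 : ∀ b → bℚ b + bℚ (not b) ≡ 1ℚ
bℚ+bℚ∘not≡1 true  = refl
bℚ+bℚ∘not≡1 false = refl

ℕtoℚ∘bℕ≡bℚ : ∀ b → ℕtoℚ (bℕ b) ≡ bℚ b
ℕtoℚ∘bℕ≡bℚ true  = refl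
ℕtoℚ∘bℕ≡bℚ false = refl

sumℚ≡∑ : (f : Fin n → ℚ) → sumℚ f ≡ ∑[ i < n ] f i
sumℚ≡∑ {zero}  f = refl
sumℚ≡∑ {suc n} f = cong (_+_ (f zero)) (sumℚ≡∑ (λ i → f (suc i)))

ℕtoℚ∘sumℕ : (f : Fin n → ℕ) → ℕtoℚ (sumℕ f) ≡ ∑[ i < n ] ℕtoℚ (f i)
ℕtoℚ∘sumℕ {zero}  f = refl
ℕtoℚ∘sumℕ {suc n} f = trans (ℕtoℚ-+ (f zero) _) (cong (_+_ (ℕtoℚ (f zero))) (ℕtoℚ∘sumℕ (λ i → f (suc i))))

∑-cong : {f g : Fin n → ℚ} → (∀ i → f i ≡ g i) → ∑[ i < n ] f i ≡ ∑[ i < n ] g i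
∑-cong = sum-cong-≗

∑-mono-≤ : {f g : Fin n → ℚ} → (∀ i → f i ≤ g i) → ∑[ i < n ] f i ≤ ∑[ i < n ] g i
∑-mono-≤ {zero}  f≤g = ≤-refl
∑-mono-≤ {suc n} f≤g = +-mono-≤ (f≤g zero) (∑-mono-≤ (λ i → f≤g (suc i)))

∑-nonNeg : {f : Fin n → ℚ} → (∀ i → 0ℚ ≤ f i) → 0ℚ ≤ ∑[ i < n ] f i
∑-nonNeg {n} 0≤f = ≤-trans (≤-reflexive (sym (sum-replicate-zero n))) (∑-mono-≤ 0≤f)

∑-const : ∀ n c → ∑[ i < n ] c ≡ ℕtoℚ n * c
∑-const zero    c = sym (*-zeroˡ c)
∑-const (suc n) c = begin
  c + ∑[ i < n ] c            ≡⟨ cong (_+_ c) (∑-const n c) ⟩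
  c + ℕtoℚ n * c              ≡⟨ factor c (ℕtoℚ n) ⟩
  (1ℚ + ℕtoℚ n) * c           ≡⟨ cong (_* c) (ℕtoℚ-+ 1 n) ⟨
  ℕtoℚ (suc n) * c            ∎
  where
  open ≡-Reasoning
  factor : ∀ c m → c + m * c ≡ (1ℚ + m) * c
  factor = solve 2 (λ c m → (c ⊕ m ⊗ c) ⊜ (Κ 1ℚ ⊕ m) ⊗ c) refl

𝟙 : Subset n → Fin n → ℚ
𝟙 A j = bℚ (lookup A j)

module _ where
  open import Data.Vec using ([]; _∷_; here)

  ∁-involutive : (A : Subset n) → ∁ (∁ A) ≡ A
  ∁-involutive []      = refl
  ∁-involutive (b ∷ A) = cong₂ _∷_ (not-involutive b) (∁-involutive A)

  ℕtoℚ∣A∣≡∑𝟙 : (A : Subset n) → ℕtoℚ ∣ A ∣ ≡ ∑[ j < n ] 𝟙 A j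
  ℕtoℚ∣A∣≡∑𝟙 []          = refl
  ℕtoℚ∣A∣≡∑𝟙 (true ∷ A)  = trans (ℕtoℚ-+ 1 ∣ A ∣) (cong (_+_ 1ℚ) (ℕtoℚ∣A∣≡∑𝟙 A))
  ℕtoℚ∣A∣≡∑𝟙 (false ∷ A) = trans (ℕtoℚ∣A∣≡∑𝟙 A) (sym (+-identityˡ _))

  ∣p∪q∣≡∣p∣+∣q∣ : (p q : Subset n) → q ⊆ ∁ p → ∣ p ∪ q ∣ ≡ ∣ p ∣ ℕ.+ ∣ q ∣
  ∣p∪q∣≡∣p∣+∣q∣ []          []          _ = refl
  ∣p∪q∣≡∣p∣+∣q∣ (true ∷ p)  (true ∷ q)  q⊆∁p with () ← q⊆∁p here
  ∣p∪q∣≡∣p∣+∣q∣ (true ∷ p)  (false ∷ q) q⊆∁p = cong suc (∣p∪q∣≡∣p∣+∣q∣ p q (drop-∷-⊆ q⊆∁p))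
  ∣p∪q∣≡∣p∣+∣q∣ (false ∷ p) (true ∷ q)  q⊆∁p =
    trans (cong suc (∣p∪q∣≡∣p∣+∣q∣ p q (drop-∷-⊆ q⊆∁p))) (sym (ℕₚ.+-suc ∣ p ∣ ∣ q ∣))
  ∣p∪q∣≡∣p∣+∣q∣ (false ∷ p) (false ∷ q) q⊆∁p = ∣p∪q∣≡∣p∣+∣q∣ p q (drop-∷-⊆ q⊆∁p)

∣p∣+∣∁p∣≡n : (A : Subset n) → ∣ A ∣ ℕ.+ ∣ ∁ A ∣ ≡ n
∣p∣+∣∁p∣≡n A = trans (cong (ℕ._+_ ∣ A ∣) (∣∁p∣≡n∸∣p∣ A)) (ℕₚ.m+[n∸m]≡n (∣p∣≤n A))

ℕtoℚ∣∁A∣≡n-∣A∣ : (A : Subset n) → ℕtoℚ ∣ ∁ A ∣ ≡ ℕtoℚ n - ℕtoℚ ∣ A ∣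
ℕtoℚ∣∁A∣≡n-∣A∣ {n} A = a+b≡c⇒b≡c-a (ℕtoℚ ∣ A ∣) (ℕtoℚ ∣ ∁ A ∣) (ℕtoℚ n)
  (trans (sym (ℕtoℚ-+ ∣ A ∣ ∣ ∁ A ∣)) (cong ℕtoℚ (∣p∣+∣∁p∣≡n A)))

infix 10 _⟨_⟩

_⟨_⟩ : (Fin n → ℚ) → Subset n → ℚ
f ⟨ A ⟩ = ∑[ j < _ ] (𝟙 A j * f j)

⟨⟩-mono-≤ : {f g : Fin n → ℚ} (A : Subset n) → (∀ j → f j ≤ g j) → f ⟨ A ⟩ ≤ g ⟨ A ⟩
⟨⟩-mono-≤ A f≤g = ∑-mono-≤ (λ j → *-monoʳ-≤ (𝟙 A j) (0≤bℚ (lookup A j)) (f≤g j))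

⟨⟩-distrib-+ : (f g : Fin n → ℚ) (A : Subset n) → (λ j → f j + g j) ⟨ A ⟩ ≡ f ⟨ A ⟩ + g ⟨ A ⟩
⟨⟩-distrib-+ f g A = trans (∑-cong (λ j → *-distribˡ-+ (𝟙 A j) (f j) (g j)))
                            (∑-distrib-+ (λ j → 𝟙 A j * f j) (λ j → 𝟙 A j * g j))

⟨⟩-nonNeg : {f : Fin n → ℚ} (A : Subset n) → (∀ j → 0ℚ ≤ f j) → 0ℚ ≤ f ⟨ A ⟩
⟨⟩-nonNeg A 0≤f = ∑-nonNeg (λ j → *-nonNeg (0≤bℚ (lookup A j)) (0≤f j))

⟨A⟩≤∑ : {f : Fin n → ℚ} (A : Subset n) → (∀ j → 0ℚ ≤ f j) → f ⟨ A ⟩ ≤ ∑[ j < n ] f j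
⟨A⟩≤∑ {f = f} A 0≤f = ∑-mono-≤ (λ j → ≤-trans (*-monoʳ-≤-nonNeg (f j) {{nonNegative (0≤f j)}} (bℚ≤1 (lookup A j)))
                                               (≤-reflexive (*-identityˡ (f j))))

⟨A⟩+⟨∁A⟩≡∑ : (f : Fin n → ℚ) (A : Subset n) → f ⟨ A ⟩ + f ⟨ ∁ A ⟩ ≡ ∑[ j < n ] f j
⟨A⟩+⟨∁A⟩≡∑ f A = trans (sym (∑-distrib-+ (λ j → 𝟙 A j * f j) (λ j → 𝟙 (∁ A) j * f j))) (∑-cong split)
  where
  split : ∀ j → 𝟙 A j * f j + 𝟙 (∁ A) j * f j ≡ f j
  split j = begin
    𝟙 A j * f j + 𝟙 (∁ A) j * f j     ≡⟨ *-distribʳ-+ (f j) (𝟙 A j) (𝟙 (∁ A) j) ⟨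
    (𝟙 A j + 𝟙 (∁ A) j) * f j         ≡⟨ cong (λ b → (𝟙 A j + bℚ b) * f j) (Vecₚ.lookup-map j not A) ⟩
    (𝟙 A j + bℚ (not (lookup A j))) * f j       ≡⟨ cong (_* f j) (bℚ+bℚ∘not≡1 (lookup A j)) ⟩
    1ℚ * f j                                              ≡⟨ *-identityˡ (f j) ⟩
    f j                                                   ∎
    where open ≡-Reasoning

const⟨A⟩ : (c : ℚ) (A : Subset n) → (λ _ → c) ⟨ A ⟩ ≡ ℕtoℚ ∣ A ∣ * c
const⟨A⟩ c A = trans (sym (*-distribʳ-sum c (λ j → 𝟙 A j))) (cong (_* c) (sym (ℕtoℚ∣A∣≡∑𝟙 A)))

mass-≤-mass+tv : (p q : Dist n) → sumℚ p ≡ sumℚ q → (A : Subset n) → q ⟨ A ⟩ ≤ p ⟨ A ⟩ + tv p q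
mass-≤-mass+tv {n} p q Σp≡Σq A = p-q≤r⇒p≤q+r (begin
  q ⟨ A ⟩ - p ⟨ A ⟩                ≤⟨ ≤-average excess-on-A excess-on-∁A ⟩
  ½ * (d ⟨ A ⟩ + d ⟨ ∁ A ⟩)        ≡⟨ cong (½ *_) (trans (⟨A⟩+⟨∁A⟩≡∑ d A) (sym (sumℚ≡∑ d))) ⟩
  tv p q                           ∎)
  where
  open ≤-Reasoning
  d : Fin n → ℚ
  d j = abs (p j - q j)
  excess-on-A : q ⟨ A ⟩ - p ⟨ A ⟩ ≤ d ⟨ A ⟩
  excess-on-A = p≤q+r⇒p-q≤r (≤-trans
    (⟨⟩-mono-≤ A (λ j → subst (λ e → q j ≤ p j + e) (∣p-q∣≡∣q-p∣ (q j) (p j)) (p≤q+∣p-q∣ (q j) (p j))))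
    (≤-reflexive (⟨⟩-distrib-+ p d A)))
  balance : q ⟨ A ⟩ - p ⟨ A ⟩ ≡ p ⟨ ∁ A ⟩ - q ⟨ ∁ A ⟩
  balance = a+a′≡b+b′⇒b-a≡a′-b′ (p ⟨ A ⟩) (p ⟨ ∁ A ⟩) (q ⟨ A ⟩) (q ⟨ ∁ A ⟩)
    (trans (⟨A⟩+⟨∁A⟩≡∑ p A) (trans (sym (sumℚ≡∑ p))
      (trans Σp≡Σq (trans (sumℚ≡∑ q) (sym (⟨A⟩+⟨∁A⟩≡∑ q A))))))
  excess-on-∁A : q ⟨ A ⟩ - p ⟨ A ⟩ ≤ d ⟨ ∁ A ⟩
  excess-on-∁A = subst (_≤ d ⟨ ∁ A ⟩) (sym balance)
    (p≤q+r⇒p-q≤r (≤-trans (⟨⟩-mono-≤ (∁ A) (λ j → p≤q+∣p-q∣ (p j) (q j))) (≤-reflexive (⟨⟩-distrib-+ q d (∁ A)))))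

edge : Graph n → Subset n → Subset n → Fin n → Fin n → Bool
edge G X Y x y = lookup X x ∧ (lookup Y y ∧ adj G x y)

ℕtoℚ-e : (G : Graph n) (X Y : Subset n) → ℕtoℚ (e G X Y) ≡ ∑[ x < n ] ∑[ y < n ] bℚ (edge G X Y x y)
ℕtoℚ-e G X Y = trans (ℕtoℚ∘sumℕ (λ x → sumℕ (λ y → bℕ (edge G X Y x y)))) (∑-cong (λ x →
                 trans (ℕtoℚ∘sumℕ (λ y → bℕ (edge G X Y x y))) (∑-cong (λ y → ℕtoℚ∘bℕ≡bℚ (edge G X Y x y)))))

e-sym : (G : Graph n) (X Y : Subset n) → ℕtoℚ (e G X Y) ≡ ℕtoℚ (e G Y X)
e-sym G X Y = begin
  ℕtoℚ (e G X Y)                                  ≡⟨ ℕtoℚ-e G X Y ⟩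
  ∑[ x < _ ] ∑[ y < _ ] bℚ (edge G X Y x y)       ≡⟨ ∑-comm (λ x y → bℚ (edge G X Y x y)) ⟩
  ∑[ y < _ ] ∑[ x < _ ] bℚ (edge G X Y x y)       ≡⟨ ∑-cong (λ y → ∑-cong (λ x → cong bℚ (swap x y))) ⟩
  ∑[ y < _ ] ∑[ x < _ ] bℚ (edge G Y X y x)       ≡⟨ ℕtoℚ-e G Y X ⟨
  ℕtoℚ (e G Y X)                                  ∎
  where
  open ≡-Reasoning
  swap : ∀ x y → lookup X x ∧ (lookup Y y ∧ adj G x y) ≡ lookup Y y ∧ (lookup X x ∧ adj G y x)
  swap x y rewrite symmetric G x y with lookup X x | lookup Y y
  ... | true  | _     = refl
  ... | false | true  = refl
  ... | false | false = refl

∪-boundary-edge : ∀ s x s′ x′ a →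
  bℚ ((s ∨ x) ∧ (not (s′ ∨ x′) ∧ a)) ≤ bℚ (s ∧ (not s′ ∧ a)) + bℚ (x ∧ ((not s′ ∧ not x′) ∧ a))
∪-boundary-edge true  x true  x′    a = +-mono-≤ (0≤bℚ false) (0≤bℚ (x ∧ (false ∧ a)))
∪-boundary-edge true  x false true  a = +-mono-≤ (0≤bℚ a) (0≤bℚ (x ∧ false))
∪-boundary-edge true  x false false a = begin
  bℚ a                    ≡⟨ +-identityʳ (bℚ a) ⟨
  bℚ a + 0ℚ               ≤⟨ +-monoʳ-≤ (bℚ a) (0≤bℚ (x ∧ a)) ⟩
  bℚ a + bℚ (x ∧ a)       ∎
  where open ≤-Reasoning
∪-boundary-edge false x true  x′    a = ≤-reflexive (sym (+-identityˡ (bℚ (x ∧ (false ∧ a)))))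
∪-boundary-edge false x false x′    a = ≤-reflexive (sym (+-identityˡ (bℚ (x ∧ (not x′ ∧ a)))))

e-∪-boundary : (G : Graph n) (S X : Subset n) →
  ℕtoℚ (e G (S ∪ X) (∁ (S ∪ X))) ≤ ℕtoℚ (e G S (∁ S)) + ℕtoℚ (e G X (∁ S ∩ ∁ X))
e-∪-boundary {n} G S X = begin
  ℕtoℚ (e G (S ∪ X) (∁ (S ∪ X)))                           ≡⟨ ℕtoℚ-e G (S ∪ X) (∁ (S ∪ X)) ⟩
  ∑[ x < n ] ∑[ y < n ] bℚ (edge G (S ∪ X) (∁ (S ∪ X)) x y)   ≤⟨ ∑-mono-≤ (λ x → ∑-mono-≤ (λ y → split x y)) ⟩
  ∑[ x < n ] ∑[ y < n ] (out-of-S x y + out-of-X x y)      ≡⟨ ∑-cong (λ x → ∑-distrib-+ (out-of-S x) (out-of-X x)) ⟩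
  ∑[ x < n ] (∑[ y < n ] out-of-S x y + ∑[ y < n ] out-of-X x y)
                     ≡⟨ ∑-distrib-+ (λ x → ∑[ y < n ] out-of-S x y) (λ x → ∑[ y < n ] out-of-X x y) ⟩
  ∑[ x < n ] ∑[ y < n ] out-of-S x y + ∑[ x < n ] ∑[ y < n ] out-of-X x y
                     ≡⟨ cong₂ _+_ (ℕtoℚ-e G S (∁ S)) (ℕtoℚ-e G X (∁ S ∩ ∁ X)) ⟨
  ℕtoℚ (e G S (∁ S)) + ℕtoℚ (e G X (∁ S ∩ ∁ X))              ∎
  where
  open ≤-Reasoning
  out-of-S out-of-X : Fin n → Fin n → ℚ
  out-of-S x y = bℚ (edge G S (∁ S) x y)
  out-of-X x y = bℚ (edge G X (∁ S ∩ ∁ X) x y)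
  split : ∀ x y → bℚ (edge G (S ∪ X) (∁ (S ∪ X)) x y) ≤ out-of-S x y + out-of-X x y
  split x y
    rewrite Vecₚ.lookup-map y not (S ∪ X) | Vecₚ.lookup-zipWith _∨_ x S X | Vecₚ.lookup-zipWith _∨_ y S X
          | Vecₚ.lookup-zipWith _∧_ y (∁ S) (∁ X) | Vecₚ.lookup-map y not S | Vecₚ.lookup-map y not X
    = ∪-boundary-edge (lookup S x) (lookup X x) (lookup S y) (lookup X y) (adj G x y)

e-⊥ : (G : Graph n) (Y : Subset n) → ℕtoℚ (e G ⊥ Y) ≡ 0ℚ
e-⊥ {n} G Y = begin
  ℕtoℚ (e G ⊥ Y)                           ≡⟨ ℕtoℚ-e G ⊥ Y ⟩
  ∑[ x < n ] ∑[ y < n ] bℚ (edge G ⊥ Y x y) ≡⟨ ∑-cong (λ x → ∑-cong (λ y →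
                                                 cong (λ b → bℚ (b ∧ (lookup Y y ∧ adj G x y))) (Vecₚ.lookup-replicate x false))) ⟩
  ∑[ x < n ] ∑[ y < n ] 0ℚ                 ≡⟨ ∑-cong {n = n} {g = λ _ → 0ℚ} (λ _ → sum-replicate-zero n) ⟩
  ∑[ x < n ] 0ℚ                            ≡⟨ sum-replicate-zero n ⟩
  0ℚ                                       ∎
  where open ≡-Reasoning

dirac : Fin n → Fin n → ℚ
dirac v j = if does (v Fin.≟ j) then 1ℚ else 0ℚ

∑-*-dirac : (f : Fin n → ℚ) (v : Fin n) → ∑[ j < n ] (f j * dirac v j) ≡ f v
∑-*-dirac {suc n} f zero = begin
  f zero * 1ℚ + ∑[ j < n ] (f (suc j) * 0ℚ)  ≡⟨ cong₂ _+_ (*-identityʳ (f zero)) (∑-cong (λ j → *-zeroʳ (f (suc j)))) ⟩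
  f zero + ∑[ j < n ] 0ℚ                     ≡⟨ cong (_+_ (f zero)) (sum-replicate-zero n) ⟩
  f zero + 0ℚ                                ≡⟨ +-identityʳ (f zero) ⟩
  f zero                                     ∎
  where open ≡-Reasoning
∑-*-dirac {suc n} f (suc v) = trans (cong₂ _+_ (*-zeroʳ (f zero)) (∑-*-dirac (λ j → f (suc j)) v)) (+-identityˡ (f (suc v)))

∑-dirac : (k : Fin n) → ∑[ v < n ] dirac v k ≡ 1ℚ
∑-dirac {suc n} zero    = cong (_+_ 1ℚ) (sum-replicate-zero n)
∑-dirac {suc n} (suc k) = trans (+-identityˡ _) (∑-dirac k)

q*r≤[b]q+q*[¬b]r : ∀ b {q r} → 0ℚ ≤ q → r ≤ 1ℚ → q * r ≤ bℚ b * q + q * (bℚ (not b) * r)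
q*r≤[b]q+q*[¬b]r true  {q} {r} 0≤q r≤1 = begin
  q * r                          ≤⟨ *-monoʳ-≤ q 0≤q r≤1 ⟩
  q * 1ℚ                         ≡⟨ solve 2 (λ q r → q ⊗ Κ 1ℚ ⊜ (Κ 1ℚ ⊗ q ⊕ q ⊗ (Κ 0ℚ ⊗ r))) refl q r ⟩
  1ℚ * q + q * (0ℚ * r)          ∎
  where open ≤-Reasoning
q*r≤[b]q+q*[¬b]r false {q} {r} _ _ = ≤-reflexive (solve 2 (λ q r → q ⊗ r ⊜ (Κ 0ℚ ⊗ q ⊕ q ⊗ (Κ 1ℚ ⊗ r))) refl q r)

module RandomWalk {n : ℕ} (D : ℕ) .{{_ : NonZero D}} (G : Graph n) (regular : Regular D G) where

  c : ℚ
  c = + 1 / D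

  P : Fin n → Fin n → ℚ
  P k j = bℚ (adj G k j) * c

  0≤P : ∀ k j → 0ℚ ≤ P k j
  0≤P k j = *-nonNeg (0≤bℚ (adj G k j)) (nonNegative⁻¹ _ {{normalize-nonNeg 1 D}})

  P-row-sum : ∀ k → ∑[ j < n ] P k j ≡ 1ℚ
  P-row-sum k = begin
    ∑[ j < n ] (bℚ (adj G k j) * c)      ≡⟨ *-distribʳ-sum c (λ j → bℚ (adj G k j)) ⟨
    (∑[ j < n ] bℚ (adj G k j)) * c      ≡⟨ cong (_* c) degree≡D ⟩
    ℕtoℚ D * c                           ≡⟨ ℕtoℚ*1/m≡1 D ⟩
    1ℚ                                           ∎
    where
    open ≡-Reasoning
    degree≡D : ∑[ j < n ] bℚ (adj G k j) ≡ ℕtoℚ D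
    degree≡D = trans (∑-cong (λ j → sym (ℕtoℚ∘bℕ≡bℚ (adj G k j))))
                     (trans (sym (ℕtoℚ∘sumℕ (λ j → bℕ (adj G k j)))) (cong ℕtoℚ (regular k)))

  P-column-sum : ∀ j → ∑[ k < n ] P k j ≡ 1ℚ
  P-column-sum j = trans (∑-cong (λ k → cong (λ b → bℚ b * c) (symmetric G k j))) (P-row-sum j)

  Q-step : ∀ t v j → Q D G (suc t) v j ≡ ∑[ k < n ] (Q D G t v k * P k j)
  Q-step t v j = sumℚ≡∑ (λ k → Q D G t v k * P k j)

  0≤Q : ∀ t v j → 0ℚ ≤ Q D G t v j
  0≤Q zero    v j with does (v Fin.≟ j)
  ... | true  = ≤ᵇ⇒≤ _
  ... | false = ≤-refl
  0≤Q (suc t) v j = subst (0ℚ ≤_) (sym (Q-step t v j)) (∑-nonNeg (λ k → *-nonNeg (0≤Q t v k) (0≤P k j)))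

  Q-row-sum : ∀ t v → ∑[ j < n ] Q D G t v j ≡ 1ℚ
  Q-row-sum zero    v = trans (∑-cong (λ j → sym (*-identityˡ (dirac v j)))) (∑-*-dirac (λ _ → 1ℚ) v)
  Q-row-sum (suc t) v = begin
    ∑[ j < n ] Q D G (suc t) v j                     ≡⟨ ∑-cong (Q-step t v) ⟩
    ∑[ j < n ] ∑[ k < n ] (Q D G t v k * P k j)      ≡⟨ ∑-comm (λ j k → Q D G t v k * P k j) ⟩
    ∑[ k < n ] ∑[ j < n ] (Q D G t v k * P k j)      ≡⟨ ∑-cong (λ k → sym (*-distribˡ-sum (Q D G t v k) (P k))) ⟩
    ∑[ k < n ] (Q D G t v k * ∑[ j < n ] P k j)      ≡⟨ ∑-cong (λ k → trans (cong (Q D G t v k *_) (P-row-sum k)) (*-identityʳ _)) ⟩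
    ∑[ k < n ] Q D G t v k                           ≡⟨ Q-row-sum t v ⟩
    1ℚ                                               ∎
    where open ≡-Reasoning

  Q-column-sum : ∀ t k → ∑[ v < n ] Q D G t v k ≡ 1ℚ
  Q-column-sum zero    k = ∑-dirac k
  Q-column-sum (suc t) j = begin
    ∑[ v < n ] Q D G (suc t) v j                     ≡⟨ ∑-cong (λ v → Q-step t v j) ⟩
    ∑[ v < n ] ∑[ k < n ] (Q D G t v k * P k j)      ≡⟨ ∑-comm (λ v k → Q D G t v k * P k j) ⟩
    ∑[ k < n ] ∑[ v < n ] (Q D G t v k * P k j)      ≡⟨ ∑-cong (λ k → sym (*-distribʳ-sum (P k j) (λ v → Q D G t v k))) ⟩
    ∑[ k < n ] ((∑[ v < n ] Q D G t v k) * P k j)    ≡⟨ ∑-cong (λ k → trans (cong (_* P k j) (Q-column-sum t k)) (*-identityˡ _)) ⟩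
    ∑[ k < n ] P k j                                 ≡⟨ P-column-sum j ⟩
    1ℚ                                               ∎
    where open ≡-Reasoning

  Q-mass-step : ∀ t v (A : Subset n) → Q D G (suc t) v ⟨ A ⟩ ≡ ∑[ k < n ] (Q D G t v k * P k ⟨ A ⟩)
  Q-mass-step t v A = begin
    ∑[ j < n ] (𝟙 A j * Q D G (suc t) v j)               ≡⟨ ∑-cong (λ j → cong (𝟙 A j *_) (Q-step t v j)) ⟩
    ∑[ j < n ] (𝟙 A j * ∑[ k < n ] (q k * P k j))        ≡⟨ ∑-cong (λ j → *-distribˡ-sum (𝟙 A j) (λ k → q k * P k j)) ⟩
    ∑[ j < n ] ∑[ k < n ] (𝟙 A j * (q k * P k j))        ≡⟨ ∑-comm (λ j k → 𝟙 A j * (q k * P k j)) ⟩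
    ∑[ k < n ] ∑[ j < n ] (𝟙 A j * (q k * P k j))        ≡⟨ ∑-cong (λ k → ∑-cong (λ j → reorder (𝟙 A j) (q k) (P k j))) ⟩
    ∑[ k < n ] ∑[ j < n ] (q k * (𝟙 A j * P k j))        ≡⟨ ∑-cong (λ k → *-distribˡ-sum (q k) (λ j → 𝟙 A j * P k j)) ⟨
    ∑[ k < n ] (q k * P k ⟨ A ⟩)                        ∎
    where
    open ≡-Reasoning
    q : Fin n → ℚ
    q = Q D G t v
    reorder : ∀ a b c → a * (b * c) ≡ b * (a * c)
    reorder = solve 3 (λ a b c → a ⊗ (b ⊗ c) ⊜ b ⊗ (a ⊗ c)) refl

  P⟨A⟩≤1 : ∀ k (A : Subset n) → P k ⟨ A ⟩ ≤ 1ℚ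
  P⟨A⟩≤1 k A = ≤-trans (⟨A⟩≤∑ A (0≤P k)) (≤-reflexive (P-row-sum k))

  Q-mass-gain : ∀ t v (A : Subset n) →
    Q D G (suc t) v ⟨ A ⟩ ≤ Q D G t v ⟨ A ⟩ + ∑[ k < n ] (Q D G t v k * (𝟙 (∁ A) k * P k ⟨ A ⟩))
  Q-mass-gain t v A = begin
    Q D G (suc t) v ⟨ A ⟩                   ≡⟨ Q-mass-step t v A ⟩
    ∑[ k < n ] (q k * P k ⟨ A ⟩)            ≤⟨ ∑-mono-≤ split ⟩
    ∑[ k < n ] (𝟙 A k * q k + q k * w k)    ≡⟨ ∑-distrib-+ (λ k → 𝟙 A k * q k) (λ k → q k * w k) ⟩
    q ⟨ A ⟩ + ∑[ k < n ] (q k * w k)        ∎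
    where
    open ≤-Reasoning
    q : Fin n → ℚ
    q = Q D G t v
    w : Fin n → ℚ
    w k = 𝟙 (∁ A) k * P k ⟨ A ⟩
    split : ∀ k → q k * P k ⟨ A ⟩ ≤ 𝟙 A k * q k + q k * w k
    split k = subst (λ b → q k * P k ⟨ A ⟩ ≤ 𝟙 A k * q k + q k * (bℚ b * P k ⟨ A ⟩))
                    (sym (Vecₚ.lookup-map k not A)) (q*r≤[b]q+q*[¬b]r (lookup A k) (0≤Q t v k) (P⟨A⟩≤1 k A))

  ∑-Q-weighted : ∀ t (w : Fin n → ℚ) → ∑[ g < n ] ∑[ k < n ] (Q D G t g k * w k) ≡ ∑[ k < n ] w k
  ∑-Q-weighted t w = begin
    ∑[ g < n ] ∑[ k < n ] (Q D G t g k * w k)      ≡⟨ ∑-comm (λ g k → Q D G t g k * w k) ⟩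
    ∑[ k < n ] ∑[ g < n ] (Q D G t g k * w k)      ≡⟨ ∑-cong (λ k → sym (*-distribʳ-sum (w k) (λ g → Q D G t g k))) ⟩
    ∑[ k < n ] ((∑[ g < n ] Q D G t g k) * w k)    ≡⟨ ∑-cong (λ k → trans (cong (_* w k) (Q-column-sum t k)) (*-identityˡ (w k))) ⟩
    ∑[ k < n ] w k                                 ∎
    where open ≡-Reasoning

  escape : ∀ t (A : Subset n) → (λ g → Q D G t g ⟨ A ⟩) ⟨ ∁ A ⟩ ≤ ℕtoℚ t * (λ k → P k ⟨ A ⟩) ⟨ ∁ A ⟩
  escape zero A = ≤-reflexive (begin
    (λ g → Q D G 0 g ⟨ A ⟩) ⟨ ∁ A ⟩    ≡⟨ ∑-cong (λ g → cong (𝟙 (∁ A) g *_) (∑-*-dirac (𝟙 A) g)) ⟩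
    ∑[ g < n ] (𝟙 (∁ A) g * 𝟙 A g)     ≡⟨ ∑-cong disjoint ⟩
    ∑[ g < n ] 0ℚ                      ≡⟨ sum-replicate-zero n ⟩
    0ℚ                                 ≡⟨ *-zeroˡ ((λ k → P k ⟨ A ⟩) ⟨ ∁ A ⟩) ⟨
    0ℚ * (λ k → P k ⟨ A ⟩) ⟨ ∁ A ⟩     ∎)
    where
    open ≡-Reasoning
    disjoint : ∀ g → bℚ (lookup (∁ A) g) * bℚ (lookup A g) ≡ 0ℚ
    disjoint g rewrite Vecₚ.lookup-map g not A with lookup A g
    ... | true  = refl
    ... | false = refl
  escape (suc t) A = begin
    (λ g → Q D G (suc t) g ⟨ A ⟩) ⟨ ∁ A ⟩             ≤⟨ ⟨⟩-mono-≤ (∁ A) (λ g → Q-mass-gain t g A) ⟩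
    (λ g → Q D G t g ⟨ A ⟩ + gain g) ⟨ ∁ A ⟩          ≡⟨ ⟨⟩-distrib-+ (λ g → Q D G t g ⟨ A ⟩) gain (∁ A) ⟩
    (λ g → Q D G t g ⟨ A ⟩) ⟨ ∁ A ⟩ + gain ⟨ ∁ A ⟩    ≤⟨ +-mono-≤ (escape t A) (⟨A⟩≤∑ (∁ A) 0≤gain) ⟩
    ℕtoℚ t * W + ∑[ g < n ] gain g                    ≡⟨ cong (_+_ (ℕtoℚ t * W)) (∑-Q-weighted t w) ⟩
    ℕtoℚ t * W + W                                    ≡⟨ factor (ℕtoℚ t) W ⟩
    (1ℚ + ℕtoℚ t) * W                                 ≡⟨ cong (_* W) (ℕtoℚ-+ 1 t) ⟨
    ℕtoℚ (suc t) * W                                  ∎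
    where
    open ≤-Reasoning
    w : Fin n → ℚ
    w k = 𝟙 (∁ A) k * P k ⟨ A ⟩
    gain : Fin n → ℚ
    gain g = ∑[ k < n ] (Q D G t g k * w k)
    0≤gain : ∀ g → 0ℚ ≤ gain g
    0≤gain g = ∑-nonNeg (λ k → *-nonNeg (0≤Q t g k) (*-nonNeg (0≤bℚ (lookup (∁ A) k)) (⟨⟩-nonNeg A (0≤P k))))
    W : ℚ
    W = (λ k → P k ⟨ A ⟩) ⟨ ∁ A ⟩
    factor : ∀ t W → t * W + W ≡ (1ℚ + t) * W
    factor = solve 2 (λ t W → (t ⊗ W ⊕ W) ⊜ (Κ 1ℚ ⊕ t) ⊗ W) refl

  flow≡e/D : (X Y : Subset n) → (λ k → P k ⟨ Y ⟩) ⟨ X ⟩ ≡ c * ℕtoℚ (e G X Y)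
  flow≡e/D X Y = begin
    ∑[ x < n ] (𝟙 X x * ∑[ y < n ] (𝟙 Y y * P x y))  ≡⟨ ∑-cong (λ x → *-distribˡ-sum (𝟙 X x) (λ y → 𝟙 Y y * P x y)) ⟩
    ∑[ x < n ] ∑[ y < n ] (𝟙 X x * (𝟙 Y y * P x y))  ≡⟨ ∑-cong (λ x → ∑-cong (λ y → edge-term x y)) ⟩
    ∑[ x < n ] ∑[ y < n ] (c * bℚ (edge G X Y x y))  ≡⟨ ∑-cong (λ x → *-distribˡ-sum c (λ y → bℚ (edge G X Y x y))) ⟨
    ∑[ x < n ] (c * ∑[ y < n ] bℚ (edge G X Y x y))  ≡⟨ *-distribˡ-sum c (λ x → ∑[ y < n ] bℚ (edge G X Y x y)) ⟨
    c * ∑[ x < n ] ∑[ y < n ] bℚ (edge G X Y x y)    ≡⟨ cong (c *_) (ℕtoℚ-e G X Y) ⟨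
    c * ℕtoℚ (e G X Y)                               ∎
    where
    open ≡-Reasoning
    reorder : ∀ a b e c → a * (b * (e * c)) ≡ c * (a * (b * e))
    reorder = solve 4 (λ a b e c → a ⊗ (b ⊗ (e ⊗ c)) ⊜ c ⊗ (a ⊗ (b ⊗ e))) refl
    edge-term : ∀ x y → 𝟙 X x * (𝟙 Y y * P x y) ≡ c * bℚ (edge G X Y x y)
    edge-term x y rewrite bℚ-∧ (lookup X x) (lookup Y y ∧ adj G x y) | bℚ-∧ (lookup Y y) (adj G x y) =
      reorder (𝟙 X x) (𝟙 Y y) (bℚ (adj G x y)) c

  escape-edges : ∀ t (A : Subset n) → (λ g → Q D G t g ⟨ A ⟩) ⟨ ∁ A ⟩ ≤ ℕtoℚ t * (c * ℕtoℚ (e G (∁ A) A))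
  escape-edges t A = subst (λ x → (λ g → Q D G t g ⟨ A ⟩) ⟨ ∁ A ⟩ ≤ ℕtoℚ t * x) (flow≡e/D (∁ A) A) (escape t A)

module Mixing {n : ℕ} .{{_ : NonZero n}} (D : ℕ) .{{_ : NonZero D}} (G : Graph n) (regular : Regular D G)
              (τ : ℕ) (δ : ℚ) where

  open RandomWalk D G regular

  good : Subset n
  good = goodStarts D G τ δ

  good⇒mixed : ∀ g → lookup good g ≡ true → tv (Q D G τ g) (Unif n) < δ
  good⇒mixed g g∈good = toWitness (Equivalence.from T-≡ (begin
    isYes mixed?                 ≡⟨ isYes≗does mixed? ⟩
    does mixed?                  ≡⟨ Vecₚ.lookup∘tabulate is-mixed g ⟨
    lookup good g                ≡⟨ g∈good ⟩
    true                         ∎))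
    where
    open ≡-Reasoning
    mixed? : Dec (tv (Q D G τ g) (Unif n) < δ)
    mixed? = tv (Q D G τ g) (Unif n) <? δ
    is-mixed : Fin n → Bool
    is-mixed v = does (tv (Q D G τ v) (Unif n) <? δ)

  mixed⇒mass≥ : ∀ g → tv (Q D G τ g) (Unif n) < δ → (A : Subset n) → ℕtoℚ ∣ A ∣ * (+ 1 / n) - δ ≤ Q D G τ g ⟨ A ⟩
  mixed⇒mass≥ g mixed A = p≤q+r⇒p-r≤q (begin
    ℕtoℚ ∣ A ∣ * (+ 1 / n)                       ≡⟨ const⟨A⟩ (+ 1 / n) A ⟨
    Unif n ⟨ A ⟩                                 ≤⟨ mass-≤-mass+tv (Q D G τ g) (Unif n) same-total A ⟩
    Q D G τ g ⟨ A ⟩ + tv (Q D G τ g) (Unif n)    ≤⟨ +-monoʳ-≤ (Q D G τ g ⟨ A ⟩) (<⇒≤ mixed) ⟩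
    Q D G τ g ⟨ A ⟩ + δ                          ∎)
    where
    open ≤-Reasoning
    same-total : sumℚ (Q D G τ g) ≡ sumℚ (Unif n)
    same-total = begin-equality
      sumℚ (Q D G τ g)          ≡⟨ trans (sumℚ≡∑ (Q D G τ g)) (Q-row-sum τ g) ⟩
      1ℚ                        ≡⟨ ℕtoℚ*1/m≡1 n ⟨
      ℕtoℚ n * (+ 1 / n)        ≡⟨ trans (sumℚ≡∑ (Unif n)) (∑-const n (+ 1 / n)) ⟨
      sumℚ (Unif n)             ∎

  expansion : (A : Subset n) {p : ℚ} → 0ℚ ≤ p →
    p ≤ ℕtoℚ ∣ A ∣ * (+ 1 / n) - δ → p ≤ ℕtoℚ ∣ ∁ A ∣ * (+ 1 / n) - δ →
    p * ℕtoℚ ∣ good ∣ ≤ ℕtoℚ τ * (c * ℕtoℚ (e G A (∁ A))) + ℕtoℚ τ * (c * ℕtoℚ (e G A (∁ A)))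
  expansion A {p} 0≤p p≤A p≤∁A = begin
    p * ℕtoℚ ∣ good ∣              ≡⟨ trans (const⟨A⟩ p good) (*-comm (ℕtoℚ ∣ good ∣) p) ⟨
    ∑[ g < n ] (𝟙 good g * p)      ≤⟨ ∑-mono-≤ contribution ⟩
    ∑[ g < n ] (𝟙 (∁ A) g * Q D G τ g ⟨ A ⟩ + 𝟙 A g * Q D G τ g ⟨ ∁ A ⟩)
                   ≡⟨ ∑-distrib-+ (λ g → 𝟙 (∁ A) g * Q D G τ g ⟨ A ⟩) (λ g → 𝟙 A g * Q D G τ g ⟨ ∁ A ⟩) ⟩
    (λ g → Q D G τ g ⟨ A ⟩) ⟨ ∁ A ⟩ + (λ g → Q D G τ g ⟨ ∁ A ⟩) ⟨ A ⟩
                   ≤⟨ +-mono-≤ (escape-edges τ A) escape-from-A ⟩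
    ℕtoℚ τ * (c * ℕtoℚ (e G (∁ A) A)) + ℕtoℚ τ * (c * ℕtoℚ (e G A (∁ A)))
                   ≡⟨ cong (λ x → ℕtoℚ τ * (c * x) + ℕtoℚ τ * (c * ℕtoℚ (e G A (∁ A)))) (e-sym G (∁ A) A) ⟩
    ℕtoℚ τ * (c * ℕtoℚ (e G A (∁ A))) + ℕtoℚ τ * (c * ℕtoℚ (e G A (∁ A))) ∎
    where
    open ≤-Reasoning
    escape-from-A : (λ g → Q D G τ g ⟨ ∁ A ⟩) ⟨ A ⟩ ≤ ℕtoℚ τ * (c * ℕtoℚ (e G A (∁ A)))
    escape-from-A = subst (λ B → (λ g → Q D G τ g ⟨ ∁ A ⟩) ⟨ B ⟩ ≤ ℕtoℚ τ * (c * ℕtoℚ (e G B (∁ A))))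
                          (∁-involutive A) (escape-edges τ (∁ A))
    0x+1y≡y : ∀ x y → 0ℚ * x + 1ℚ * y ≡ y
    0x+1y≡y = solve 2 (λ x y → (Κ 0ℚ ⊗ x ⊕ Κ 1ℚ ⊗ y) ⊜ y) refl
    1x+0y≡x : ∀ x y → 1ℚ * x + 0ℚ * y ≡ x
    1x+0y≡x = solve 2 (λ x y → (Κ 1ℚ ⊗ x ⊕ Κ 0ℚ ⊗ y) ⊜ x) refl
    contribution : ∀ g →
      bℚ (lookup good g) * p ≤ bℚ (lookup (∁ A) g) * Q D G τ g ⟨ A ⟩ + bℚ (lookup A g) * Q D G τ g ⟨ ∁ A ⟩
    contribution g with lookup good g in g∈good
    ... | false = ≤-trans (≤-reflexive (*-zeroˡ p))
                          (+-mono-≤ (*-nonNeg (0≤bℚ (lookup (∁ A) g)) (⟨⟩-nonNeg A (0≤Q τ g)))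
                                    (*-nonNeg (0≤bℚ (lookup A g)) (⟨⟩-nonNeg (∁ A) (0≤Q τ g))))
    ... | true rewrite Vecₚ.lookup-map g not A | *-identityˡ p with lookup A g
    ...   | true  = ≤-trans (≤-trans p≤∁A (mixed⇒mass≥ g (good⇒mixed g g∈good) (∁ A)))
                            (≤-reflexive (sym (0x+1y≡y (Q D G τ g ⟨ A ⟩) (Q D G τ g ⟨ ∁ A ⟩))))
    ...   | false = ≤-trans (≤-trans p≤A (mixed⇒mass≥ g (good⇒mixed g g∈good) A))
                            (≤-reflexive (sym (1x+0y≡x (Q D G τ g ⟨ A ⟩) (Q D G τ g ⟨ ∁ A ⟩))))

module GreedyClosure {n : ℕ} (Inv : Subset n → Set) (Bad : Subset n → Subset n → Set) (bad? : ∀ S X → Dec (Bad S X))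
                     (grow : ∀ {S X} → Inv S → Bad S X → Inv (S ∪ X) × ∣ S ∣ ℕ.< ∣ S ∪ X ∣) where

  closure-within : ∀ k {S} → n ℕ.∸ ∣ S ∣ ℕ.< k → Inv S → Σ (Subset n) λ S′ → Inv S′ × (∀ X → ¬ Bad S′ X)
  closure-within (suc k) {S} room inv with anySubset? (bad? S)
  ... | no  no-bad       = S , inv , λ X bad → no-bad (X , bad)
  ... | yes (X , bad) with grow inv bad
  ...   | inv′ , grew = closure-within k (ℕₚ.<-≤-trans (ℕₚ.∸-monoʳ-< grew (∣p∣≤n (S ∪ X))) (ℕₚ.≤-pred room)) inv′

  closure : ∀ S → Inv S → Σ (Subset n) λ S′ → Inv S′ × (∀ X → ¬ Bad S′ X)
  closure S = closure-within (suc n) (ℕ.s≤s (ℕₚ.m∸n≤m n ∣ S ∣))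

m≤d⇒m≤5d : ∀ {m d} → 0ℚ ≤ d → m ≤ d → m ≤ + 5 / 1 * d
m≤d⇒m≤5d {m} {d} 0≤d m≤d = 0≤q-p⇒p≤q (begin
  0ℚ                          ≤⟨ +-mono-≤ (p≤q⇒0≤q-p m≤d) (scale-nonNeg (+ 4 / 1) 0≤d) ⟩
  (d - m) + + 4 / 1 * d       ≡⟨ solve 2 (λ m d → (d ⊕ ⊝ m ⊕ Κ (+ 4 / 1) ⊗ d) ⊜ (Κ (+ 5 / 1) ⊗ d ⊕ ⊝ m)) refl m d ⟩
  + 5 / 1 * d - m             ∎)
  where open ≤-Reasoning

m-d≤m/8⇒m≤5d : ∀ {m d} → 0ℚ ≤ d → m - d ≤ m * (+ 1 / 8) → m ≤ + 5 / 1 * d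
m-d≤m/8⇒m≤5d {m} {d} 0≤d m-d≤m/8 = 0≤q-p⇒p≤q (begin
  0ℚ                                              ≤⟨ +-mono-≤ (scale-nonNeg (+ 8 / 7) (p≤q⇒0≤q-p m-d≤m/8))
                                                               (scale-nonNeg (+ 27 / 7) 0≤d) ⟩
  + 8 / 7 * (m * (+ 1 / 8) - (m - d)) + + 27 / 7 * d
    ≡⟨ solve 2 (λ m d → (Κ (+ 8 / 7) ⊗ (m ⊗ Κ (+ 1 / 8) ⊕ ⊝ (m ⊕ ⊝ d)) ⊕ Κ (+ 27 / 7) ⊗ d)
                        ⊜ (Κ (+ 5 / 1) ⊗ d ⊕ ⊝ m)) refl m d ⟩
  + 5 / 1 * d - m                                 ∎)
  where open ≤-Reasoning

module LargeSide {N δ s m : ℚ} (0<N : 0ℚ < N) (δ≤1/30 : δ ≤ + 1 / 30) (s≤5δN : s ≤ + 5 / 1 * δ * N)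
                 (2m≤N+s : m + m ≤ N + s) where

  private
    slack-δ : 0ℚ ≤ N * (+ 1 / 30 - δ)
    slack-δ = *-nonNeg (<⇒≤ 0<N) (p≤q⇒0≤q-p δ≤1/30)

  0≤N-m-δN : 0ℚ ≤ (N - m) - δ * N
  0≤N-m-δN = begin
    0ℚ   ≤⟨ +-mono-≤ (+-mono-≤ (+-mono-≤ (scale-nonNeg ½ (p≤q⇒0≤q-p 2m≤N+s)) (scale-nonNeg ½ (p≤q⇒0≤q-p s≤5δN)))
                               (scale-nonNeg (+ 7 / 2) slack-δ))
                     (scale-nonNeg (+ 23 / 60) (<⇒≤ 0<N)) ⟩
    ½ * ((N + s) - (m + m)) + ½ * (+ 5 / 1 * δ * N - s) + + 7 / 2 * (N * (+ 1 / 30 - δ)) + + 23 / 60 * N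
         ≡⟨ solve 4 (λ N δ s m → (Κ ½ ⊗ (N ⊕ s ⊕ ⊝ (m ⊕ m)) ⊕ Κ ½ ⊗ (Κ (+ 5 / 1) ⊗ δ ⊗ N ⊕ ⊝ s)
                                  ⊕ Κ (+ 7 / 2) ⊗ (N ⊗ (Κ (+ 1 / 30) ⊕ ⊝ δ)) ⊕ Κ (+ 23 / 60) ⊗ N)
                                 ⊜ (N ⊕ ⊝ m ⊕ ⊝ (δ ⊗ N))) refl N δ s m ⟩
    (N - m) - δ * N  ∎
    where open ≤-Reasoning

  -- 16·(m/8 − (N − m − δN)) + 9·(N + s − 2m) + 9·(5δN − s) + 61·N(1/30 − δ) = −149N/30 < 0.
  N-m-δN≰m/8 : ¬ ((N - m) - δ * N ≤ m * (+ 1 / 8))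
  N-m-δN≰m/8 μ≤m/8 = <-irrefl refl (<-≤-trans 0<N (0≤q-p⇒p≤q (begin
    0ℚ   ≤⟨ scale-nonNeg (+ 30 / 149) (+-mono-≤ (+-mono-≤ (+-mono-≤
               (scale-nonNeg (+ 16 / 1) (p≤q⇒0≤q-p μ≤m/8)) (scale-nonNeg (+ 9 / 1) (p≤q⇒0≤q-p 2m≤N+s)))
               (scale-nonNeg (+ 9 / 1) (p≤q⇒0≤q-p s≤5δN))) (scale-nonNeg (+ 61 / 1) slack-δ)) ⟩
    + 30 / 149 * (+ 16 / 1 * (m * (+ 1 / 8) - ((N - m) - δ * N)) + + 9 / 1 * ((N + s) - (m + m))
                  + + 9 / 1 * (+ 5 / 1 * δ * N - s) + + 61 / 1 * (N * (+ 1 / 30 - δ)))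
         ≡⟨ solve 4 (λ N δ s m → Κ (+ 30 / 149) ⊗ (Κ (+ 16 / 1) ⊗ (m ⊗ Κ (+ 1 / 8) ⊕ ⊝ (N ⊕ ⊝ m ⊕ ⊝ (δ ⊗ N)))
                                   ⊕ Κ (+ 9 / 1) ⊗ (N ⊕ s ⊕ ⊝ (m ⊕ m)) ⊕ Κ (+ 9 / 1) ⊗ (Κ (+ 5 / 1) ⊗ δ ⊗ N ⊕ ⊝ s)
                                   ⊕ Κ (+ 61 / 1) ⊗ (N ⊗ (Κ (+ 1 / 30) ⊕ ⊝ δ)))
                                 ⊜ (Κ 0ℚ ⊕ ⊝ N)) refl N δ s m ⟩
    0ℚ - N ∎)))
    where open ≤-Reasoning

grown-set-stays-small : ∀ {N δ s m} → 0ℚ < N → 0ℚ ≤ δ → δ ≤ + 1 / 30 →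
  s ≤ + 5 / 1 * δ * N → m + m ≤ N + s →
  (∀ μ → 0ℚ ≤ μ → μ ≤ m - δ * N → μ ≤ (N - m) - δ * N → μ ≤ m * (+ 1 / 8)) →
  m ≤ + 5 / 1 * δ * N
grown-set-stays-small {N} {δ} {s} {m} 0<N 0≤δ δ≤1/30 s≤5δN 2m≤N+s expands with m + m ≤? N | m ≤? δ * N
... | yes _    | yes m≤δN = subst (m ≤_) (sym (*-assoc (+ 5 / 1) δ N)) (m≤d⇒m≤5d (*-nonNeg 0≤δ (<⇒≤ 0<N)) m≤δN)
... | yes 2m≤N | no m≰δN = subst (m ≤_) (sym (*-assoc (+ 5 / 1) δ N)) (m-d≤m/8⇒m≤5d (*-nonNeg 0≤δ (<⇒≤ 0<N))
    (expands (m - δ * N) (p≤q⇒0≤q-p (<⇒≤ (≰⇒> m≰δN))) ≤-refl (+-monoˡ-≤ (- (δ * N)) (p+p≤q⇒p≤q-p 2m≤N))))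
... | no 2m≰N  | _ = ⊥-elim (N-m-δN≰m/8 (expands ((N - m) - δ * N) 0≤N-m-δN
                                                  (+-monoˡ-≤ (- (δ * N)) (p≤q+r⇒p-q≤r (<⇒≤ (≰⇒> 2m≰N)))) ≤-refl))
  where open LargeSide {N} {δ} {s} {m} 0<N δ≤1/30 s≤5δN 2m≤N+s

x≤½[N-s]⇒2[s+x]≤N+s : ∀ N s x → x ≤ + 1 / 2 * (N - s) → (s + x) + (s + x) ≤ N + s
x≤½[N-s]⇒2[s+x]≤N+s N s x x≤½[N-s] = 0≤q-p⇒p≤q (begin
  0ℚ                                ≤⟨ scale-nonNeg (+ 2 / 1) (p≤q⇒0≤q-p x≤½[N-s]) ⟩
  + 2 / 1 * (+ 1 / 2 * (N - s) - x)
      ≡⟨ solve 3 (λ N s x → Κ (+ 2 / 1) ⊗ (Κ (+ 1 / 2) ⊗ (N ⊕ ⊝ s) ⊕ ⊝ x) ⊜ (N ⊕ s ⊕ ⊝ (s ⊕ x ⊕ (s ⊕ x))))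
                 refl N s x ⟩
  (N + s) - ((s + x) + (s + x))     ∎)
  where open ≤-Reasoning

module Pruning (ε δ : ℚ) (0<ε : 0ℚ < ε) (0<δ : 0ℚ < δ) (δ≤1/30 : δ ≤ + 1 / 30)
               (τ : ℕ) .{{_ : NonZero τ}} (D : ℕ) .{{_ : NonZero D}} (n : ℕ) .{{_ : NonZero n}}
               (G : Graph n) (regular : Regular D G) (many-good : ε * ℕtoℚ n ≤ ℕtoℚ ∣ goodStarts D G τ δ ∣) where

  open Mixing D G regular τ δ

  N : ℚ
  N = ℕtoℚ n

  threshold : ℕ → ℚ
  threshold m = ε * ℕtoℚ D * ℕtoℚ m * (+ 1 / 16) * (+ 1 / τ)

  threshold-+ : ∀ a b → threshold a + threshold b ≡ threshold (a ℕ.+ b)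
  threshold-+ a b = trans (distrib ε (ℕtoℚ D) (+ 1 / τ) (ℕtoℚ a) (ℕtoℚ b))
                          (cong (λ m → ε * ℕtoℚ D * m * (+ 1 / 16) * (+ 1 / τ)) (sym (ℕtoℚ-+ a b)))
    where
    distrib : ∀ ε D t a b → ε * D * a * (+ 1 / 16) * t + ε * D * b * (+ 1 / 16) * t ≡ ε * D * (a + b) * (+ 1 / 16) * t
    distrib = solve 5 (λ ε D t a b → (ε ⊗ D ⊗ a ⊗ Κ (+ 1 / 16) ⊗ t ⊕ ε ⊗ D ⊗ b ⊗ Κ (+ 1 / 16) ⊗ t)
                                     ⊜ ε ⊗ D ⊗ (a ⊕ b) ⊗ Κ (+ 1 / 16) ⊗ t) refl

  threshold-0 : threshold 0 ≡ 0ℚ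
  threshold-0 = zero-factor ε (ℕtoℚ D) (+ 1 / τ)
    where
    zero-factor : ∀ ε D t → ε * D * 0ℚ * (+ 1 / 16) * t ≡ 0ℚ
    zero-factor = solve 3 (λ ε D t → ε ⊗ D ⊗ Κ 0ℚ ⊗ Κ (+ 1 / 16) ⊗ t ⊜ Κ 0ℚ) refl

  per-vertex : ∀ {μ} a → μ ≤ a - δ * N → μ * (+ 1 / n) ≤ a * (+ 1 / n) - δ
  per-vertex {μ} a μ≤a-δN = begin
    μ * (+ 1 / n)                        ≤⟨ *-monoʳ-≤-nonNeg (+ 1 / n) {{normalize-nonNeg 1 n}} μ≤a-δN ⟩
    (a - δ * N) * (+ 1 / n)              ≡⟨ distrib a δ N (+ 1 / n) ⟩
    a * (+ 1 / n) - δ * (N * (+ 1 / n))  ≡⟨ cong (λ x → a * (+ 1 / n) - δ * x) (ℕtoℚ*1/m≡1 n) ⟩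
    a * (+ 1 / n) - δ * 1ℚ               ≡⟨ cong (λ x → a * (+ 1 / n) - x) (*-identityʳ δ) ⟩
    a * (+ 1 / n) - δ                    ∎
    where
    open ≤-Reasoning
    distrib : ∀ a δ N u → (a - δ * N) * u ≡ a * u - δ * (N * u)
    distrib = solve 4 (λ a δ N u → (a ⊕ ⊝ (δ ⊗ N)) ⊗ u ⊜ (a ⊗ u ⊕ ⊝ (δ ⊗ (N ⊗ u)))) refl

  sparse-cut⇒lopsided : (A : Subset n) → ℕtoℚ (e G A (∁ A)) ≤ threshold ∣ A ∣ →
    ∀ μ → 0ℚ ≤ μ → μ ≤ ℕtoℚ ∣ A ∣ - δ * N → μ ≤ (N - ℕtoℚ ∣ A ∣) - δ * N → μ ≤ ℕtoℚ ∣ A ∣ * (+ 1 / 8)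
  sparse-cut⇒lopsided A sparse μ 0≤μ μ≤A μ≤∁A = *-cancelˡ-≤-pos ε {{positive 0<ε}} (begin
    ε * μ                                     ≡⟨ *-identityʳ (ε * μ) ⟨
    ε * μ * 1ℚ                                ≡⟨ cong (ε * μ *_) (ℕtoℚ*1/m≡1 n) ⟨
    ε * μ * (N * u)                           ≡⟨ reorder ε μ N u ⟩
    (μ * u) * (ε * N)                         ≤⟨ *-monoʳ-≤ (μ * u) 0≤μu many-good ⟩
    (μ * u) * ℕtoℚ ∣ good ∣                   ≤⟨ expansion A 0≤μu (per-vertex (ℕtoℚ ∣ A ∣) μ≤A) μu≤∁A ⟩
    τ′ * (c * E) + τ′ * (c * E)               ≤⟨ +-mono-≤ bound bound ⟩
    τ′ * (c * threshold ∣ A ∣) + τ′ * (c * threshold ∣ A ∣)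
                                              ≡⟨ regroup τ′ c ε (ℕtoℚ D) (ℕtoℚ ∣ A ∣) (+ 1 / τ) ⟩
    ε * (ℕtoℚ ∣ A ∣ * (+ 1 / 8)) * ((ℕtoℚ D * c) * (τ′ * (+ 1 / τ)))
                                              ≡⟨ cong₂ (λ x y → ε * (ℕtoℚ ∣ A ∣ * (+ 1 / 8)) * (x * y))
                                                       (ℕtoℚ*1/m≡1 D) (ℕtoℚ*1/m≡1 τ) ⟩
    ε * (ℕtoℚ ∣ A ∣ * (+ 1 / 8)) * 1ℚ         ≡⟨ *-identityʳ _ ⟩
    ε * (ℕtoℚ ∣ A ∣ * (+ 1 / 8))              ∎)
    where
    open ≤-Reasoning
    u c τ′ E : ℚ
    u = + 1 / n
    c = + 1 / D
    τ′ = ℕtoℚ τ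
    E = ℕtoℚ (e G A (∁ A))
    0≤μu : 0ℚ ≤ μ * u
    0≤μu = *-nonNeg 0≤μ (nonNegative⁻¹ u {{normalize-nonNeg 1 n}})
    μu≤∁A : μ * u ≤ ℕtoℚ ∣ ∁ A ∣ * u - δ
    μu≤∁A = subst (λ a → μ * u ≤ a * u - δ) (sym (ℕtoℚ∣∁A∣≡n-∣A∣ A)) (per-vertex (N - ℕtoℚ ∣ A ∣) μ≤∁A)
    bound : τ′ * (c * E) ≤ τ′ * (c * threshold ∣ A ∣)
    bound = *-monoʳ-≤ τ′ (0≤ℕtoℚ τ) (*-monoʳ-≤ c (nonNegative⁻¹ c {{normalize-nonNeg 1 D}}) sparse)
    reorder : ∀ ε μ N u → ε * μ * (N * u) ≡ (μ * u) * (ε * N)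
    reorder = solve 4 (λ ε μ N u → ε ⊗ μ ⊗ (N ⊗ u) ⊜ μ ⊗ u ⊗ (ε ⊗ N)) refl
    regroup : ∀ τ c ε D a t → τ * (c * (ε * D * a * (+ 1 / 16) * t)) + τ * (c * (ε * D * a * (+ 1 / 16) * t))
                              ≡ ε * (a * (+ 1 / 8)) * ((D * c) * (τ * t))
    regroup = solve 6 (λ τ c ε D a t → (τ ⊗ (c ⊗ (ε ⊗ D ⊗ a ⊗ Κ (+ 1 / 16) ⊗ t)) ⊕ τ ⊗ (c ⊗ (ε ⊗ D ⊗ a ⊗ Κ (+ 1 / 16) ⊗ t)))
                                       ⊜ ε ⊗ (a ⊗ Κ (+ 1 / 8)) ⊗ (D ⊗ c ⊗ (τ ⊗ t))) refl

  Invariant : Subset n → Set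
  Invariant S = ℕtoℚ ∣ S ∣ ≤ + 5 / 1 * δ * N × ℕtoℚ (e G S (∁ S)) ≤ threshold ∣ S ∣

  Sparse : Subset n → Subset n → Set
  Sparse S X = X ⊆ ∁ S × ℕtoℚ ∣ X ∣ ≤ + 1 / 2 * ℕtoℚ ∣ ∁ S ∣ × ℕtoℚ (e G X (∁ S ∩ ∁ X)) < threshold ∣ X ∣

  sparse? : ∀ S X → Dec (Sparse S X)
  sparse? S X = X ⊆? ∁ S
         ×-dec ℕtoℚ ∣ X ∣ ≤? + 1 / 2 * ℕtoℚ ∣ ∁ S ∣
         ×-dec ℕtoℚ (e G X (∁ S ∩ ∁ X)) <? threshold ∣ X ∣

  invariant-⊥ : Invariant ⊥
  invariant-⊥ = small , boundary
    where
    open ≤-Reasoning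
    small : ℕtoℚ ∣ ⊥ {n = n} ∣ ≤ + 5 / 1 * δ * N
    small = begin
      ℕtoℚ ∣ ⊥ {n = n} ∣     ≡⟨ cong ℕtoℚ (∣⊥∣≡0 n) ⟩
      0ℚ                     ≤⟨ *-nonNeg (scale-nonNeg (+ 5 / 1) (<⇒≤ 0<δ)) (0≤ℕtoℚ n) ⟩
      + 5 / 1 * δ * N        ∎
    boundary : ℕtoℚ (e G ⊥ (∁ ⊥)) ≤ threshold ∣ ⊥ {n = n} ∣
    boundary = begin
      ℕtoℚ (e G ⊥ (∁ ⊥))     ≡⟨ e-⊥ G (∁ ⊥) ⟩
      0ℚ                     ≡⟨ threshold-0 ⟨
      threshold 0            ≡⟨ cong threshold (∣⊥∣≡0 n) ⟨
      threshold ∣ ⊥ {n = n} ∣ ∎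

  grow : ∀ {S X} → Invariant S → Sparse S X → Invariant (S ∪ X) × ∣ S ∣ ℕ.< ∣ S ∪ X ∣
  grow {S} {X} (S-small , S-boundary) (X⊆∁S , X-half , X-sparse) = (size , boundary) , strict
    where
    ∣S∪X∣ : ∣ S ∪ X ∣ ≡ ∣ S ∣ ℕ.+ ∣ X ∣
    ∣S∪X∣ = ∣p∪q∣≡∣p∣+∣q∣ S X X⊆∁S
    boundary : ℕtoℚ (e G (S ∪ X) (∁ (S ∪ X))) ≤ threshold ∣ S ∪ X ∣
    boundary = begin
      ℕtoℚ (e G (S ∪ X) (∁ (S ∪ X)))                   ≤⟨ e-∪-boundary G S X ⟩
      ℕtoℚ (e G S (∁ S)) + ℕtoℚ (e G X (∁ S ∩ ∁ X))     ≤⟨ +-mono-≤ S-boundary (<⇒≤ X-sparse) ⟩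
      threshold (∣ S ∣) + threshold (∣ X ∣)             ≡⟨ threshold-+ ∣ S ∣ ∣ X ∣ ⟩
      threshold (∣ S ∣ ℕ.+ ∣ X ∣)                       ≡⟨ cong threshold ∣S∪X∣ ⟨
      threshold ∣ S ∪ X ∣                               ∎
      where open ≤-Reasoning
    doubled : ℕtoℚ (∣ S ∪ X ∣) + ℕtoℚ (∣ S ∪ X ∣) ≤ N + ℕtoℚ ∣ S ∣
    doubled = subst (λ m → m + m ≤ N + ℕtoℚ ∣ S ∣) (trans (sym (ℕtoℚ-+ ∣ S ∣ ∣ X ∣)) (cong ℕtoℚ (sym ∣S∪X∣)))
                    (x≤½[N-s]⇒2[s+x]≤N+s N (ℕtoℚ ∣ S ∣) (ℕtoℚ ∣ X ∣)
                      (subst (λ c → ℕtoℚ ∣ X ∣ ≤ + 1 / 2 * c) (ℕtoℚ∣∁A∣≡n-∣A∣ S) X-half))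
    size : ℕtoℚ ∣ S ∪ X ∣ ≤ + 5 / 1 * δ * N
    size = grown-set-stays-small (positive⁻¹ N {{normalize-pos n 1}}) (<⇒≤ 0<δ) δ≤1/30 S-small doubled
                                 (sparse-cut⇒lopsided (S ∪ X) boundary)
    X-nonempty : ∣ X ∣ ≢ 0
    X-nonempty ∣X∣≡0 = <-irrefl refl (≤-<-trans (0≤ℕtoℚ (e G X (∁ S ∩ ∁ X)))
                         (subst (ℕtoℚ (e G X (∁ S ∩ ∁ X)) <_) (trans (cong threshold ∣X∣≡0) threshold-0) X-sparse))
    strict : ∣ S ∣ ℕ.< ∣ S ∪ X ∣
    strict = subst (∣ S ∣ ℕ.<_) (sym ∣S∪X∣) (ℕₚ.m<m+n ∣ S ∣ (ℕₚ.n≢0⇒n>0 X-nonempty))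

theorem1p1 : (ε δ : ℚ) → 0ℚ < ε → ε < + 2 / 5 → 0ℚ < δ → δ ≤ + 1 / 30 →
    (τ : ℕ) → .{{_ : NonZero τ}} →
    (D : ℕ) → .{{_ : NonZero D}} →
    (n : ℕ) → .{{_ : NonZero n}} →
    (G : Graph n) → Regular D G →
    ε * ℕtoℚ n ≤ ℕtoℚ ∣ goodStarts D G τ δ ∣ →
    Σ (Subset n) (λ V′ →
      (ℕtoℚ ∣ V′ ∣ ≤ (+ 5 / 1) * δ * ℕtoℚ n) ×
      ((X : Subset n) → X ⊆ ∁ V′ →
        ℕtoℚ ∣ X ∣ ≤ (+ 1 / 2) * ℕtoℚ ∣ ∁ V′ ∣ →
        ε * ℕtoℚ D * ℕtoℚ ∣ X ∣ * (+ 1 / 16) * (+ 1 / τ) ≤ ℕtoℚ (e G X ((∁ V′) ∩ (∁ X)))))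
theorem1p1 ε δ 0<ε _ 0<δ δ≤1/30 τ D n G regular many-good =
  let V′ , (V′-small , _) , no-sparse = closure ⊥ invariant-⊥
  in  V′ , V′-small , λ X X⊆∁V′ X-half → ≮⇒≥ (λ X-sparse → no-sparse X (X⊆∁V′ , X-half , X-sparse))
  where
  open Pruning ε δ 0<ε 0<δ δ≤1/30 τ D n G regular many-good
  open GreedyClosure Invariant Sparse sparse? grow
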